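{- Let $1\leq t\leq k-2$ and $2k\leq n$, let $\mathcal{F}\subseteq\binom{[n]}{k}$ be a maximal $t$-intersecting family with $\tau_t(\mathcal{F})=t+1$, and let $\mathcal{T}=\{T\in\binom{[n]}{t+1}: |T\cap F|\geq t \text{ for all } F\in\mathcal{F}\}$. Then: (i) if $|\mathcal{T}|=1$, then $|\mathcal{F}|\leq\binom{n-t-1}{k-t-1}+(t+1)(k-t)(k-t+1)\binom{n-t-2}{k-t-2}$; (ii) if $|\mathcal{T}|\geq 2$ and $\mathcal{T}=\{T\in\binom{M}{t+1}: X\subseteq T\}$ for some $t$-subset $X$ and $l$-subset $M$ of $[n]$ with $X\subseteq M$, then $$|\mathcal{F}|\leq (l-t)\binom{n-t-1}{k-t-1}+(k-l+1)(k-t+1)\binom{n-t-2}{k-t-2}+t\binom{n-l}{k-l+1},$$ and moreover, if $l=t+2$, then $|\mathcal{F}|\leq 2\binom{n-t-1}{k-t-1}+(k-1)(k-t+1)\binom{n-t-2}{k-t-2}$; (iii) if $|\mathcal{T}|\geq 2$ and $\mathcal{T}=\binom{Z}{t+1}$ for some $(t+2)$-subset $Z$ of $[n]$, then $|\mathcal{F}|=h_2(t+2)$.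
   Context: $\binom{[n]}{k}$ denotes the family of $k$-subsets of $[n]=\{1,\ldots,n\}$. A family $\mathcal{G}$ of sets is $t$-intersecting if $|A\cap B|\geq t$ for all $A,B\in\mathcal{G}$. "Maximal" means maximal under inclusion among $t$-intersecting subfamilies of $\binom{[n]}{k}$. The $t$-covering number $\tau_t(\mathcal{G})$ of a family $\mathcal{G}$ of subsets of $[n]$ is the minimum size of a subset $T\subseteq[n]$ with $|T\cap G|\geq t$ for all $G\in\mathcal{G}$. $h_2(t+2)=|\{F\in\binom{[n]}{k}: |F\cap Z|\geq t+1\}|$ for any $(t+2)$-subset $Z$ of $[n]$. -}

module Defs where

open import Data.Nat using (ℕ; zero; suc; _≤_; _+_; _≡ᵇ_; _≤ᵇ_)
open import Data.Bool using (Bool; true; false; _∨_; _∧_; not)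
import Data.Bool.Properties as BoolP
open import Data.Fin.Subset using (Subset; _∩_; _⊆_; ∣_∣)
open import Data.Vec using (Vec; []; _∷_)
open import Data.Vec.Properties using (≡-dec)
open import Data.List using (List; []; _∷_; _++_; map; length; filterᵇ)
open import Data.List.Membership.Propositional using (_∈_)
open import Data.List.Relation.Unary.Unique.Propositional using (Unique)
open import Data.Product using (Σ; _×_)
open import Relation.Nullary using (¬_; does)
open import Relation.Binary.PropositionalEquality using (_≡_)
open import Function.Bundles using (_⇔_)

-- All subsets of [n] = Fin n (as characteristic vectors), each exactly once.
allSubsets : (n : ℕ) → List (Subset n)
allSubsets zero = [] ∷ []
allSubsets (suc n) = map (false ∷_) (allSubsets n) ++ map (true ∷_) (allSubsets n)

Family : ℕ → Set
Family n = Subset n → Bool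

card : {n : ℕ} → Family n → ℕ
card {n} 𝓕 = length (filterᵇ 𝓕 (allSubsets n))

IsKUniform : {n : ℕ} → ℕ → Family n → Set
IsKUniform k 𝓕 = ∀ A → 𝓕 A ≡ true → ∣ A ∣ ≡ k

IsTIntersecting : {n : ℕ} → ℕ → Family n → Set
IsTIntersecting t 𝓕 = ∀ A B → 𝓕 A ≡ true → 𝓕 B ≡ true → t ≤ ∣ A ∩ B ∣

insertFam : {n : ℕ} → Family n → Subset n → Family n
insertFam 𝓕 G A = 𝓕 A ∨ does (≡-dec BoolP._≟_ A G)

IsMaximalTIntersecting : {n : ℕ} → ℕ → ℕ → Family n → Set
IsMaximalTIntersecting k t 𝓕 =
  IsKUniform k 𝓕 × IsTIntersecting t 𝓕 ×
  (∀ G → ∣ G ∣ ≡ k → 𝓕 G ≡ false → ¬ IsTIntersecting t (insertFam 𝓕 G))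

TCovers : {n : ℕ} → ℕ → Family n → Subset n → Set
TCovers t 𝓕 T = ∀ G → 𝓕 G ≡ true → t ≤ ∣ T ∩ G ∣

TCoveringNumberIs : {n : ℕ} → ℕ → Family n → ℕ → Set
TCoveringNumberIs t 𝓕 m =
  Σ _ (λ T → TCovers t 𝓕 T × ∣ T ∣ ≡ m) × (∀ T → TCovers t 𝓕 T → m ≤ ∣ T ∣)

𝒯 : {n : ℕ} → ℕ → Family n → Subset n → Set
𝒯 t 𝓕 T = ∣ T ∣ ≡ suc t × TCovers t 𝓕 T

HasCard : {n : ℕ} → (Subset n → Set) → ℕ → Set
HasCard {n} P m = Σ (List (Subset n)) (λ L → Unique L × (∀ T → (T ∈ L) ⇔ P T) × length L ≡ m)

-- h₂(t+2) computed with a given (t+2)-set Z: #{ F ∈ binom([n],k) : |F ∩ Z| ≥ t+1 }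
h₂ : {n : ℕ} → ℕ → ℕ → Subset n → ℕ
h₂ k t Z = card (λ A → (∣ A ∣ ≡ᵇ k) ∧ (suc t ≤ᵇ ∣ A ∩ Z ∣))

module Submission where

-- Every bound is a union bound.  We cover 𝓕 by "stars" (all k-supersets of a set W, size
-- C(n - |W|, k - |W|)) or "layers" (all k-sets between W and Y) and add up their sizes.  The
-- stars come from a branching argument: if S is not a t-cover, some member G meets S in fewer
-- than t points (a deficient member), and every member A with A ∩ R ⊆ S must then contain a
-- point of G ─ R; as G meets a known t-cover in t points, G ─ R is small.
--   (i)   One cover T₀: a member contains T₀, or T₀ - x and two further points found by
--         branching from T₀ - x and then from (T₀ - x) ∪ {y}.
--   (ii)  𝒯 = {X ∪ {m} : m ∈ M ─ X}: a member containing X meets M ─ X or branches twice from X;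
--         a member missing x ∈ X contains M - x (and branches once more when l = t + 2).
--   (iii) 𝒯 = binom(Z, t + 1): 𝓕 is exactly the family of k-sets meeting Z in t + 1 points.

open import Defs
open import Data.Nat using (ℕ; zero; suc; _≤_; _≰_; _<_; _+_; _*_; _∸_; _≡ᵇ_; _≤ᵇ_; z≤n; s≤s)
open import Data.Nat.Properties
open import Data.Nat.Combinatorics using (_C_; nCk+nC[k+1]≡[n+1]C[k+1])
open import Data.Bool using (Bool; true; false; _∨_; _∧_; if_then_else_)
open import Data.Bool.Properties using (T-≡; T-∧; ∧-zeroʳ)
open import Data.Fin using (Fin; zero; suc)
import Data.Fin as Fin
open import Data.Fin.Subset
  using (Subset; inside; outside; _∩_; _∪_; _─_; _-_; ∁; ⁅_⁆; ⊤; ⊥; _⊆_; ∣_∣; Nonempty)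
  renaming (_∈_ to _∈ₛ_; _∉_ to _∉ₛ_)
open import Data.Fin.Subset.Properties
open import Data.Vec using ([]; _∷_; here; there)
open import Data.Vec.Properties using (≡-dec)
open import Data.List using (List; []; _∷_; _++_; map; length; filterᵇ)
open import Data.List.Properties using (length-++; filter-++)
import Data.List.Relation.Unary.Any as Any
open import Data.Product using (∃; _×_; _,_; proj₁; proj₂)
open import Data.Sum using (_⊎_; inj₁; inj₂)
open import Function.Bundles using (Equivalence; _⇔_)
open import Relation.Nullary using (¬_; Dec; does; yes; no; contradiction)
open import Relation.Nullary.Decidable using (dec-true; _×-dec_; decidable-stable)
import Data.Bool as Bool
open import Data.Empty using (⊥-elim)
open import Function.Base using (_∘_)
open import Relation.Binary.PropositionalEquality
open import Data.Nat.Tactic.RingSolver using (solve-∀)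
open import Algebra.Properties.CommutativeSemigroup +-commutativeSemigroup
  using () renaming (interchange to +-interchange)

open Equivalence using (to; from)

count : (n : ℕ) → Family n → ℕ
count zero    P = if P [] then 1 else 0
count (suc n) P = count n (λ A → P (outside ∷ A)) + count n (λ A → P (inside ∷ A))

length-filter-map : ∀ {A B : Set} (P : B → Bool) (f : A → B) (xs : List A) →
  length (filterᵇ P (map f xs)) ≡ length (filterᵇ (λ a → P (f a)) xs)
length-filter-map P f [] = refl
length-filter-map P f (x ∷ xs) with P (f x)
... | true  = cong suc (length-filter-map P f xs)
... | false = length-filter-map P f xs

card≡count : ∀ {n} (P : Family n) → card P ≡ count n P
card≡count {zero} P with P []
... | true  = refl
... | false = refl
card≡count {suc n} P = begin
  length (filterᵇ P (map (outside ∷_) subs ++ map (inside ∷_) subs))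
    ≡⟨ cong length (filter-++ _ (map (outside ∷_) subs) _) ⟩
  length (filterᵇ P (map (outside ∷_) subs) ++ filterᵇ P (map (inside ∷_) subs))
    ≡⟨ length-++ (filterᵇ P (map (outside ∷_) subs)) ⟩
  length (filterᵇ P (map (outside ∷_) subs)) + length (filterᵇ P (map (inside ∷_) subs))
    ≡⟨ cong₂ _+_ (trans (length-filter-map P (outside ∷_) subs) (card≡count {n} _))
                 (trans (length-filter-map P (inside ∷_) subs) (card≡count {n} _)) ⟩
  count (suc n) P ∎
  where
  open ≡-Reasoning
  subs : List (Subset n)
  subs = allSubsets n

count-mono : ∀ n {P Q : Family n} → (∀ A → P A ≡ true → Q A ≡ true) → count n P ≤ count n Q
count-mono zero {P} {Q} P⇒Q with P [] in eq
... | false = z≤n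
... | true rewrite P⇒Q [] eq = ≤-refl
count-mono (suc n) P⇒Q =
  +-mono-≤ (count-mono n (λ A → P⇒Q (outside ∷ A))) (count-mono n (λ A → P⇒Q (inside ∷ A)))

count-cong : ∀ n {P Q : Family n} → (∀ A → P A ≡ true → Q A ≡ true) →
  (∀ A → Q A ≡ true → P A ≡ true) → count n P ≡ count n Q
count-cong n P⇒Q Q⇒P = ≤-antisym (count-mono n P⇒Q) (count-mono n Q⇒P)

count-none : ∀ n {P : Family n} → (∀ A → P A ≡ false) → count n P ≡ 0
count-none zero    none rewrite none [] = refl
count-none (suc n) none
  rewrite count-none n (λ A → none (outside ∷ A)) | count-none n (λ A → none (inside ∷ A)) = refl

count-∨ : ∀ n (P Q : Family n) → count n (λ A → P A ∨ Q A) ≤ count n P + count n Q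
count-∨ zero P Q with P [] | Q []
... | true  | true  = s≤s z≤n
... | true  | false = ≤-refl
... | false | _     = ≤-refl
count-∨ (suc n) P Q = ≤-trans (+-mono-≤ (count-∨ n _ _) (count-∨ n _ _))
  (≤-reflexive (+-interchange (count n (λ A → P (outside ∷ A))) (count n (λ A → Q (outside ∷ A)))
                              (count n (λ A → P (inside ∷ A))) (count n (λ A → Q (inside ∷ A)))))

∨-introˡ : ∀ {a} b → a ≡ true → a ∨ b ≡ true
∨-introˡ b refl = refl

∨-introʳ : ∀ a {b} → b ≡ true → a ∨ b ≡ true
∨-introʳ true  _ = refl
∨-introʳ false b≡true = b≡true

Union : ∀ {r n} → Subset r → (Fin r → Family n) → Family n
Union []            Q A = false
Union (inside  ∷ R) Q A = Q zero A ∨ Union R (λ x → Q (suc x)) A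
Union (outside ∷ R) Q A = Union R (λ x → Q (suc x)) A

Union-intro : ∀ {r n} {R : Subset r} {Q : Fin r → Family n} {x A} →
  x ∈ₛ R → Q x A ≡ true → Union R Q A ≡ true
Union-intro {R = inside ∷ R}  {Q} {A = A} here      QxA rewrite QxA = refl
Union-intro {R = inside ∷ R}  {Q} {A = A} (there x∈R) QxA with Q zero A
... | true  = refl
... | false = Union-intro x∈R QxA
Union-intro {R = outside ∷ R} (there x∈R) QxA = Union-intro x∈R QxA

count-Union : ∀ {r} n (R : Subset r) (Q : Fin r → Family n) {d b} → ∣ R ∣ ≤ d →
  (∀ x → x ∈ₛ R → count n (Q x) ≤ b) → count n (Union R Q) ≤ d * b
count-Union n R Q {d} {b} ∣R∣≤d bound = ≤-trans (count-⋃ R Q bound) (*-monoˡ-≤ b ∣R∣≤d)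
  where
  count-⋃ : ∀ {r} (R : Subset r) (Q : Fin r → Family n) →
    (∀ x → x ∈ₛ R → count n (Q x) ≤ b) → count n (Union R Q) ≤ ∣ R ∣ * b
  count-⋃ []            Q bound = ≤-reflexive (count-none n (λ _ → refl))
  count-⋃ (inside  ∷ R) Q bound =
    ≤-trans (count-∨ n (Q zero) (Union R (λ x → Q (suc x))))
            (+-mono-≤ (bound zero here) (count-⋃ R _ (λ x x∈R → bound (suc x) (there x∈R))))
  count-⋃ (outside ∷ R) Q bound = count-⋃ R _ (λ x x∈R → bound (suc x) (there x∈R))

Layer : ∀ {n} → ℕ → Subset n → Subset n → Family n
Layer k W Y A = (∣ A ∣ ≡ᵇ k) ∧ (does (W ⊆? A) ∧ does (A ⊆? Y))

Layer-intro : ∀ {n k} {W Y A : Subset n} → W ⊆ A → A ⊆ Y → ∣ A ∣ ≡ k → Layer k W Y A ≡ true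
Layer-intro {W = W} {Y} {A} W⊆A A⊆Y refl
  rewrite dec-true (W ⊆? A) W⊆A | dec-true (A ⊆? Y) A⊆Y = to T-≡ (from T-∧ (≡⇒≡ᵇ ∣ A ∣ ∣ A ∣ refl , _))

Layer-size : ∀ {n k} {W Y A : Subset n} → Layer k W Y A ≡ true → ∣ W ∣ ≤ k
Layer-size {k = k} {W} {Y} {A} L with W ⊆? A
... | yes W⊆A = ≤-trans (p⊆q⇒∣p∣≤∣q∣ W⊆A) (≤-reflexive (≡ᵇ⇒≡ ∣ A ∣ k (proj₁ (to T-∧ (from T-≡ L)))))
... | no  _   = ⊥-elim (proj₂ (to T-∧ (from T-≡ L)))

count-Layer-empty : ∀ n {k} {W Y : Subset n} → k < ∣ W ∣ → count n (Layer k W Y) ≡ 0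
count-Layer-empty n {k} {W} {Y} k<W = count-none n empty
  where
  empty : ∀ A → Layer k W Y A ≡ false
  empty A with Layer k W Y A in L
  ... | true  = contradiction (Layer-size {W = W} {Y} {A} L) (<⇒≱ k<W)
  ... | false = refl

-- Pascal's rule, in the form needed when a coordinate lies in Y but not in W.
pascal-step : ∀ {y w k a b} → w ≤ y → a ≤ (y ∸ w) C (suc k ∸ w) → b ≤ (y ∸ w) C (k ∸ w) →
  (k < w → b ≡ 0) → a + b ≤ (suc y ∸ w) C (suc k ∸ w)
pascal-step {y} {w} {k} {a} {b} w≤y a≤ b≤ small with w ≤? k
... | yes w≤k rewrite +-∸-assoc 1 w≤k | +-∸-assoc 1 w≤y = begin
  a + b                                        ≤⟨ +-mono-≤ a≤ b≤ ⟩
  (y ∸ w) C suc (k ∸ w) + (y ∸ w) C (k ∸ w)    ≡⟨ +-comm ((y ∸ w) C suc (k ∸ w)) _ ⟩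
  (y ∸ w) C (k ∸ w) + (y ∸ w) C suc (k ∸ w)    ≡⟨ nCk+nC[k+1]≡[n+1]C[k+1] (y ∸ w) (k ∸ w) ⟩
  suc (y ∸ w) C suc (k ∸ w)                    ∎
  where open ≤-Reasoning
... | no  w≰k rewrite small (≰⇒> w≰k) | +-identityʳ a | m≤n⇒m∸n≡0 (≰⇒> w≰k) = a≤

-- Induction on n,
-- splitting on the first coordinate: one in W is forced into A, one outside Y is forced out,
-- and one in Y ─ W splits the count as in Pascal's rule.
count-Layer : ∀ n k (W Y : Subset n) → W ⊆ Y → count n (Layer k W Y) ≤ (∣ Y ∣ ∸ ∣ W ∣) C (k ∸ ∣ W ∣)
count-Layer zero    zero    [] [] _ = ≤-refl
count-Layer zero    (suc k) [] [] _ = z≤n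
count-Layer (suc n) k (inside ∷ W) (outside ∷ Y) W⊆Y with () ← W⊆Y here
count-Layer (suc n) k (inside ∷ W) (inside ∷ Y) W⊆Y
  rewrite count-none n {λ A → Layer k (inside ∷ W) (inside ∷ Y) (outside ∷ A)} (λ A → ∧-zeroʳ _)
  with k
... | zero  rewrite count-none n {λ A → Layer zero (inside ∷ W) (inside ∷ Y) (inside ∷ A)} (λ A → refl) = z≤n
... | suc k = count-Layer n k W Y (drop-∷-⊆ W⊆Y)
count-Layer (suc n) k (outside ∷ W) (outside ∷ Y) W⊆Y
  rewrite count-none n {λ A → Layer k (outside ∷ W) (outside ∷ Y) (inside ∷ A)}
                       (λ A → trans (cong ((suc ∣ A ∣ ≡ᵇ k) ∧_) (∧-zeroʳ (does (W ⊆? A)))) (∧-zeroʳ _))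
        | +-identityʳ (count n (Layer k W Y)) = count-Layer n k W Y (drop-∷-⊆ W⊆Y)
count-Layer (suc n) zero (outside ∷ W) (inside ∷ Y) W⊆Y
  rewrite count-none n {λ A → Layer zero (outside ∷ W) (inside ∷ Y) (inside ∷ A)} (λ A → refl)
        | +-identityʳ (count n (Layer zero W Y))
  = ≤-trans (count-Layer n zero W Y (drop-∷-⊆ W⊆Y))
            (≤-reflexive (trans (cong ((∣ Y ∣ ∸ ∣ W ∣) C_) (0∸n≡0 ∣ W ∣))
                                (cong ((suc ∣ Y ∣ ∸ ∣ W ∣) C_) (sym (0∸n≡0 ∣ W ∣)))))
count-Layer (suc n) (suc k) (outside ∷ W) (inside ∷ Y) W⊆Y =
  pascal-step (p⊆q⇒∣p∣≤∣q∣ (drop-∷-⊆ W⊆Y))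
    (count-Layer n (suc k) W Y (drop-∷-⊆ W⊆Y)) (count-Layer n k W Y (drop-∷-⊆ W⊆Y))
    (count-Layer-empty n {k} {W} {Y})

Star : ∀ {n} → ℕ → Subset n → Family n
Star k W = Layer k W ⊤

Star-intro : ∀ {n k} {W A : Subset n} → W ⊆ A → ∣ A ∣ ≡ k → Star k W A ≡ true
Star-intro W⊆A refl = Layer-intro W⊆A ⊆⊤ refl

count-Star : ∀ n k (W : Subset n) → count n (Star k W) ≤ (n ∸ ∣ W ∣) C (k ∸ ∣ W ∣)
count-Star n k W = subst (λ m → count n (Star k W) ≤ (m ∸ ∣ W ∣) C (k ∸ ∣ W ∣)) (∣⊤∣≡n n)
                         (count-Layer n k W ⊤ ⊆⊤)

count-Star-size : ∀ n k t j (W : Subset n) → ∣ W ∣ ≡ t + j →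
  count n (Star k W) ≤ (n ∸ t ∸ j) C (k ∸ t ∸ j)
count-Star-size n k t j W ∣W∣≡ rewrite ∸-+-assoc n t j | ∸-+-assoc k t j | sym ∣W∣≡ = count-Star n k W

∣p∣+∣q∣≡∣p∪q∣+∣p∩q∣ : ∀ {n} (p q : Subset n) → ∣ p ∣ + ∣ q ∣ ≡ ∣ p ∪ q ∣ + ∣ p ∩ q ∣
∣p∣+∣q∣≡∣p∪q∣+∣p∩q∣ []            []            = refl
∣p∣+∣q∣≡∣p∪q∣+∣p∩q∣ (inside  ∷ p) (inside  ∷ q) = cong suc (begin
  ∣ p ∣ + suc ∣ q ∣          ≡⟨ +-suc ∣ p ∣ ∣ q ∣ ⟩
  suc (∣ p ∣ + ∣ q ∣)        ≡⟨ cong suc (∣p∣+∣q∣≡∣p∪q∣+∣p∩q∣ p q) ⟩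
  suc (∣ p ∪ q ∣ + ∣ p ∩ q ∣) ≡⟨ +-suc ∣ p ∪ q ∣ ∣ p ∩ q ∣ ⟨
  ∣ p ∪ q ∣ + suc ∣ p ∩ q ∣  ∎)
  where open ≡-Reasoning
∣p∣+∣q∣≡∣p∪q∣+∣p∩q∣ (inside  ∷ p) (outside ∷ q) = cong suc (∣p∣+∣q∣≡∣p∪q∣+∣p∩q∣ p q)
∣p∣+∣q∣≡∣p∪q∣+∣p∩q∣ (outside ∷ p) (inside  ∷ q) =
  trans (+-suc ∣ p ∣ ∣ q ∣) (cong suc (∣p∣+∣q∣≡∣p∪q∣+∣p∩q∣ p q))
∣p∣+∣q∣≡∣p∪q∣+∣p∩q∣ (outside ∷ p) (outside ∷ q) = ∣p∣+∣q∣≡∣p∪q∣+∣p∩q∣ p q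

∣p∪q∣≤∣p∣+∣q∣ : ∀ {n} (p q : Subset n) → ∣ p ∪ q ∣ ≤ ∣ p ∣ + ∣ q ∣
∣p∪q∣≤∣p∣+∣q∣ p q = ≤-trans (m≤m+n ∣ p ∪ q ∣ ∣ p ∩ q ∣) (≤-reflexive (sym (∣p∣+∣q∣≡∣p∪q∣+∣p∩q∣ p q)))

∣p∩r∣+∣q∩r∣≤∣p∩q∣+∣r∣ : ∀ {n} (p q r : Subset n) → ∣ p ∩ r ∣ + ∣ q ∩ r ∣ ≤ ∣ p ∩ q ∣ + ∣ r ∣
∣p∩r∣+∣q∩r∣≤∣p∩q∣+∣r∣ p q r = begin
  ∣ p ∩ r ∣ + ∣ q ∩ r ∣                                  ≡⟨ ∣p∣+∣q∣≡∣p∪q∣+∣p∩q∣ (p ∩ r) (q ∩ r) ⟩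
  ∣ (p ∩ r) ∪ (q ∩ r) ∣ + ∣ (p ∩ r) ∩ (q ∩ r) ∣          ≤⟨ +-mono-≤ (p⊆q⇒∣p∣≤∣q∣ ∪⊆r) (p⊆q⇒∣p∣≤∣q∣ ∩⊆p∩q) ⟩
  ∣ r ∣ + ∣ p ∩ q ∣                                      ≡⟨ +-comm ∣ r ∣ _ ⟩
  ∣ p ∩ q ∣ + ∣ r ∣                                      ∎
  where
  open ≤-Reasoning
  ∪⊆r : (p ∩ r) ∪ (q ∩ r) ⊆ r
  ∪⊆r x∈ with x∈p∪q⁻ (p ∩ r) (q ∩ r) x∈
  ... | inj₁ x∈p∩r = p∩q⊆q p r x∈p∩r
  ... | inj₂ x∈q∩r = p∩q⊆q q r x∈q∩r
  ∩⊆p∩q : (p ∩ r) ∩ (q ∩ r) ⊆ p ∩ q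
  ∩⊆p∩q x∈ = let (x∈p∩r , x∈q∩r) = x∈p∩q⁻ (p ∩ r) (q ∩ r) x∈
             in x∈p∩q⁺ (p∩q⊆p p r x∈p∩r , p∩q⊆p q r x∈q∩r)

∣p∣≡∣p∩q∣+∣p─q∣ : ∀ {n} (p q : Subset n) → ∣ p ∣ ≡ ∣ p ∩ q ∣ + ∣ p ─ q ∣
∣p∣≡∣p∩q∣+∣p─q∣ []            []            = refl
∣p∣≡∣p∩q∣+∣p─q∣ (inside  ∷ p) (inside  ∷ q) = cong suc (∣p∣≡∣p∩q∣+∣p─q∣ p q)
∣p∣≡∣p∩q∣+∣p─q∣ (inside  ∷ p) (outside ∷ q) =
  trans (cong suc (∣p∣≡∣p∩q∣+∣p─q∣ p q)) (sym (+-suc ∣ p ∩ q ∣ ∣ p ─ q ∣))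
∣p∣≡∣p∩q∣+∣p─q∣ (outside ∷ p) (inside  ∷ q) = ∣p∣≡∣p∩q∣+∣p─q∣ p q
∣p∣≡∣p∩q∣+∣p─q∣ (outside ∷ p) (outside ∷ q) = ∣p∣≡∣p∩q∣+∣p─q∣ p q

x∈p─q⇒x∉q : ∀ {n} {x : Fin n} (p q : Subset n) → x ∈ₛ p ─ q → x ∉ₛ q
x∈p─q⇒x∉q (inside ∷ p) (outside ∷ q) here        ()
x∈p─q⇒x∉q (_      ∷ p) (inside  ∷ q) (there x∈) (there x∈q) = x∈p─q⇒x∉q p q x∈ x∈q
x∈p─q⇒x∉q (_      ∷ p) (outside ∷ q) (there x∈) (there x∈q) = x∈p─q⇒x∉q p q x∈ x∈q

Nonempty⇒1≤∣p∣ : ∀ {n} {p : Subset n} → Nonempty p → 1 ≤ ∣ p ∣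
Nonempty⇒1≤∣p∣ {p = p} (x , x∈p) =
  subst (_≤ ∣ p ∣) (∣⁅x⁆∣≡1 x) (p⊆q⇒∣p∣≤∣q∣ (λ y∈⁅x⁆ → subst (_∈ₛ p) (sym (x∈⁅y⁆⇒x≡y x y∈⁅x⁆)) x∈p))

1≤∣p∣⇒Nonempty : ∀ {n} {p : Subset n} → 1 ≤ ∣ p ∣ → Nonempty p
1≤∣p∣⇒Nonempty {n} {p} 1≤∣p∣ with nonempty? p
... | yes ne = ne
... | no  e  = contradiction (subst (λ q → 1 ≤ ∣ q ∣) (Empty-unique e) 1≤∣p∣)
                             (subst (1 ≰_) (sym (∣⊥∣≡0 n)) λ ())

⊆-or-Nonempty─ : ∀ {n} (p q : Subset n) → p ⊆ q ⊎ Nonempty (p ─ q)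
⊆-or-Nonempty─ p q with nonempty? (p ─ q)
... | yes ne = inj₂ ne
... | no  e  = inj₁ p⊆q
  where
  p⊆q : p ⊆ q
  p⊆q {x} x∈p with x ∈? q
  ... | yes x∈q = x∈q
  ... | no  x∉q = contradiction (x , x∈p∧x∉q⇒x∈p─q x∈p x∉q) e

∣p∣≤∣p∩q∣⇒p⊆q : ∀ {n} {p q : Subset n} → ∣ p ∣ ≤ ∣ p ∩ q ∣ → p ⊆ q
∣p∣≤∣p∩q∣⇒p⊆q {p = p} {q} ∣p∣≤ with ⊆-or-Nonempty─ p q
... | inj₁ p⊆q = p⊆q
... | inj₂ ne  = contradiction ∣p∣≤ (<⇒≱ (begin-strict
  ∣ p ∩ q ∣                 <⟨ m<m+n ∣ p ∩ q ∣ (Nonempty⇒1≤∣p∣ ne) ⟩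
  ∣ p ∩ q ∣ + ∣ p ─ q ∣     ≡⟨ ∣p∣≡∣p∩q∣+∣p─q∣ p q ⟨
  ∣ p ∣                     ∎))
  where open ≤-Reasoning

larger⇒Nonempty─ : ∀ {n} {T X : Subset n} → ∣ X ∣ < ∣ T ∣ → Nonempty (T ─ X)
larger⇒Nonempty─ {T = T} {X} ∣X∣<∣T∣ = 1≤∣p∣⇒Nonempty (≤-trans (m<n⇒0<n∸m ∣T∩X∣<∣T∣) ∣T∣∸∣T∩X∣≤)
  where
  ∣T∩X∣<∣T∣ : ∣ T ∩ X ∣ < ∣ T ∣
  ∣T∩X∣<∣T∣ = ≤-<-trans (∣p∩q∣≤∣q∣ T X) ∣X∣<∣T∣
  ∣T∣∸∣T∩X∣≤ : ∣ T ∣ ∸ ∣ T ∩ X ∣ ≤ ∣ T ─ X ∣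
  ∣T∣∸∣T∩X∣≤ = ≤-reflexive (trans (cong (_∸ ∣ T ∩ X ∣) (∣p∣≡∣p∩q∣+∣p─q∣ T X)) (m+n∸m≡n ∣ T ∩ X ∣ _))

x∈p⇒∣p∣≡1+∣p-x∣ : ∀ {n} {x : Fin n} {p : Subset n} → x ∈ₛ p → ∣ p ∣ ≡ suc ∣ p - x ∣
x∈p⇒∣p∣≡1+∣p-x∣ {x = x} {p} x∈p = begin
  ∣ p ∣                          ≡⟨ ∣p∣≡∣p∩q∣+∣p─q∣ p ⁅ x ⁆ ⟩
  ∣ p ∩ ⁅ x ⁆ ∣ + ∣ p - x ∣      ≡⟨ cong (λ q → ∣ q ∣ + ∣ p - x ∣) p∩⁅x⁆≡⁅x⁆ ⟩
  ∣ ⁅ x ⁆ ∣ + ∣ p - x ∣          ≡⟨ cong (_+ ∣ p - x ∣) (∣⁅x⁆∣≡1 x) ⟩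
  suc ∣ p - x ∣                  ∎
  where
  open ≡-Reasoning
  p∩⁅x⁆≡⁅x⁆ : p ∩ ⁅ x ⁆ ≡ ⁅ x ⁆
  p∩⁅x⁆≡⁅x⁆ = ⊆-antisym (p∩q⊆q p ⁅ x ⁆)
    (λ y∈⁅x⁆ → x∈p∩q⁺ (subst (_∈ₛ p) (sym (x∈⁅y⁆⇒x≡y x y∈⁅x⁆)) x∈p , y∈⁅x⁆))

x∉p⇒∣p∪⁅x⁆∣≡1+∣p∣ : ∀ {n} {x : Fin n} {p : Subset n} → x ∉ₛ p → ∣ p ∪ ⁅ x ⁆ ∣ ≡ suc ∣ p ∣
x∉p⇒∣p∪⁅x⁆∣≡1+∣p∣ {n} {x} {p} x∉p = begin
  ∣ p ∪ ⁅ x ⁆ ∣                  ≡⟨ +-identityʳ _ ⟨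
  ∣ p ∪ ⁅ x ⁆ ∣ + 0              ≡⟨ cong (∣ p ∪ ⁅ x ⁆ ∣ +_) ∣p∩⁅x⁆∣≡0 ⟨
  ∣ p ∪ ⁅ x ⁆ ∣ + ∣ p ∩ ⁅ x ⁆ ∣  ≡⟨ ∣p∣+∣q∣≡∣p∪q∣+∣p∩q∣ p ⁅ x ⁆ ⟨
  ∣ p ∣ + ∣ ⁅ x ⁆ ∣              ≡⟨ cong (∣ p ∣ +_) (∣⁅x⁆∣≡1 x) ⟩
  ∣ p ∣ + 1                      ≡⟨ +-comm ∣ p ∣ 1 ⟩
  suc ∣ p ∣                      ∎
  where
  open ≡-Reasoning
  ∣p∩⁅x⁆∣≡0 : ∣ p ∩ ⁅ x ⁆ ∣ ≡ 0
  ∣p∩⁅x⁆∣≡0 = trans (cong ∣_∣ (Empty-unique λ { (y , y∈) →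
    let (y∈p , y∈⁅x⁆) = x∈p∩q⁻ p ⁅ x ⁆ y∈ in x∉p (subst (_∈ₛ p) (x∈⁅y⁆⇒x≡y x y∈⁅x⁆) y∈p) }))
    (∣⊥∣≡0 n)

∪⁅⁆-⊆ : ∀ {n} {p A : Subset n} {x : Fin n} → p ⊆ A → x ∈ₛ A → p ∪ ⁅ x ⁆ ⊆ A
∪⁅⁆-⊆ {p = p} {x = x} p⊆A x∈A y∈ with x∈p∪q⁻ p ⁅ x ⁆ y∈
... | inj₁ y∈p    = p⊆A y∈p
... | inj₂ y∈⁅x⁆  = subst (_∈ₛ _) (sym (x∈⁅y⁆⇒x≡y x y∈⁅x⁆)) x∈A

p∩A⊆[p-x]∩A : ∀ {n} {x : Fin n} {A : Subset n} (p : Subset n) → x ∉ₛ A → p ∩ A ⊆ (p - x) ∩ A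
p∩A⊆[p-x]∩A {x = x} {A} p x∉A y∈ =
  let (y∈p , y∈A) = x∈p∩q⁻ p A y∈
  in x∈p∩q⁺ (x∈p∧x≢y⇒x∈p-y y∈p (λ { refl → x∉A y∈A }) , y∈A)

∣G─R∣≤ : ∀ {n k s e} (G R : Subset n) → ∣ G ∣ ≡ k → s ≤ ∣ R ∩ G ∣ + e → ∣ G ─ R ∣ ≤ k + e ∸ s
∣G─R∣≤ {k = k} {s} {e} G R ∣G∣≡k s≤ = m+n≤o⇒m≤o∸n ∣ G ─ R ∣ (begin
  ∣ G ─ R ∣ + s                    ≤⟨ +-monoʳ-≤ ∣ G ─ R ∣ s≤ ⟩
  ∣ G ─ R ∣ + (∣ R ∩ G ∣ + e)      ≡⟨ +-assoc ∣ G ─ R ∣ _ e ⟨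
  ∣ G ─ R ∣ + ∣ R ∩ G ∣ + e        ≡⟨ cong (_+ e) (+-comm ∣ G ─ R ∣ _) ⟩
  ∣ R ∩ G ∣ + ∣ G ─ R ∣ + e        ≡⟨ cong (λ q → ∣ q ∣ + ∣ G ─ R ∣ + e) (∩-comm R G) ⟩
  ∣ G ∩ R ∣ + ∣ G ─ R ∣ + e        ≡⟨ cong (_+ e) (trans (sym (∣p∣≡∣p∩q∣+∣p─q∣ G R)) ∣G∣≡k) ⟩
  k + e                            ∎)
  where open ≤-Reasoning

-- Deficient members and the branching step, for an arbitrary family 𝓕 ⊆ 2^[n].
module Covers {n : ℕ} (t : ℕ) (𝓕 : Family n) where

  Deficient : Subset n → Subset n → Set
  Deficient S G = 𝓕 G ≡ true × ∣ S ∩ G ∣ < t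

  deficient? : ∀ S G → Dec (Deficient S G)
  deficient? S G = (𝓕 G Bool.≟ true) ×-dec (suc ∣ S ∩ G ∣ ≤? t)

  deficient : Subset n → Subset n
  deficient S with anySubset? (deficient? S)
  ... | yes (G , _) = G
  ... | no  _       = ⊥

  deficient-spec : ∀ S → ¬ TCovers t 𝓕 S → Deficient S (deficient S)
  deficient-spec S ¬cover with anySubset? (deficient? S)
  ... | yes (_ , def) = def
  ... | no  none      = contradiction cover ¬cover
    where
    cover : TCovers t 𝓕 S
    cover G 𝓕G with t ≤? ∣ S ∩ G ∣
    ... | yes t≤ = t≤
    ... | no  t≰ = contradiction (G , 𝓕G , ≰⇒> t≰) none

  escape : IsTIntersecting t 𝓕 → ∀ {S R G A} → Deficient S G → 𝓕 A ≡ true →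
    (∀ {x} → x ∈ₛ A → x ∈ₛ R → x ∈ₛ S) → ∃ λ z → z ∈ₛ A × z ∈ₛ G ─ R
  escape intersecting {S} {R} {G} {A} (𝓕G , ∣S∩G∣<t) 𝓕A A∩R⊆S with ⊆-or-Nonempty─ (A ∩ G) R
  ... | inj₂ (z , z∈) =
    let (z∈A∩G , z∉R) = (p─q⊆p (A ∩ G) R z∈ , x∈p─q⇒x∉q (A ∩ G) R z∈)
        (z∈A , z∈G)   = x∈p∩q⁻ A G z∈A∩G
    in z , z∈A , x∈p∧x∉q⇒x∈p─q z∈G z∉R
  ... | inj₁ A∩G⊆R = contradiction (intersecting A G 𝓕A 𝓕G) (<⇒≱ (≤-<-trans ∣A∩G∣≤∣S∩G∣ ∣S∩G∣<t))
    where
    ∣A∩G∣≤∣S∩G∣ : ∣ A ∩ G ∣ ≤ ∣ S ∩ G ∣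
    ∣A∩G∣≤∣S∩G∣ = p⊆q⇒∣p∣≤∣q∣ λ x∈ →
      let (x∈A , x∈G) = x∈p∩q⁻ A G x∈ in x∈p∩q⁺ (A∩R⊆S x∈A (A∩G⊆R x∈) , x∈G)

  cover-minus-one : ∀ {T R m B} → TCovers t 𝓕 T → T ⊆ R ∪ ⁅ m ⁆ → 𝓕 B ≡ true →
    t ≤ ∣ R ∩ B ∣ + 1
  cover-minus-one {T} {R} {m} {B} cover T⊆ 𝓕B = begin
    t                           ≤⟨ cover B 𝓕B ⟩
    ∣ T ∩ B ∣                   ≤⟨ p⊆q⇒∣p∣≤∣q∣ T∩B⊆ ⟩
    ∣ (R ∩ B) ∪ ⁅ m ⁆ ∣         ≤⟨ ∣p∪q∣≤∣p∣+∣q∣ (R ∩ B) ⁅ m ⁆ ⟩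
    ∣ R ∩ B ∣ + ∣ ⁅ m ⁆ ∣       ≡⟨ cong (∣ R ∩ B ∣ +_) (∣⁅x⁆∣≡1 m) ⟩
    ∣ R ∩ B ∣ + 1               ∎
    where
    open ≤-Reasoning
    T∩B⊆ : T ∩ B ⊆ (R ∩ B) ∪ ⁅ m ⁆
    T∩B⊆ x∈ with x∈p∩q⁻ T B x∈
    ... | x∈T , x∈B with x∈p∪q⁻ R ⁅ m ⁆ (T⊆ x∈T)
    ...   | inj₁ x∈R = x∈p∪q⁺ (inj₁ (x∈p∩q⁺ (x∈R , x∈B)))
    ...   | inj₂ x∈⁅m⁆ = x∈p∪q⁺ (inj₂ x∈⁅m⁆)

  cover-forces : ∀ {T R m B} → TCovers t 𝓕 T → T ⊆ R ∪ ⁅ m ⁆ → 𝓕 B ≡ true →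
    ∣ R ∩ B ∣ < t → m ∈ₛ B
  cover-forces {T} {R} {m} {B} cover T⊆ 𝓕B ∣R∩B∣<t with m ∈? B
  ... | yes m∈B = m∈B
  ... | no  m∉B = contradiction (≤-trans (cover B 𝓕B) (p⊆q⇒∣p∣≤∣q∣ T∩B⊆R∩B)) (<⇒≱ ∣R∩B∣<t)
    where
    T∩B⊆R∩B : T ∩ B ⊆ R ∩ B
    T∩B⊆R∩B x∈ with x∈p∩q⁻ T B x∈
    ... | x∈T , x∈B with x∈p∪q⁻ R ⁅ m ⁆ (T⊆ x∈T)
    ...   | inj₁ x∈R   = x∈p∩q⁺ (x∈R , x∈B)
    ...   | inj₂ x∈⁅m⁆ = contradiction (subst (_∈ₛ B) (x∈⁅y⁆⇒x≡y m x∈⁅m⁆) x∈B) m∉B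

small-not-cover : ∀ {n t} {𝓕 : Family n} → (∀ T → TCovers t 𝓕 T → suc t ≤ ∣ T ∣) →
  ∀ {S} → ∣ S ∣ ≡ t → ¬ TCovers t 𝓕 S
small-not-cover minimal {S} ∣S∣≡t cover = <-irrefl (sym ∣S∣≡t) (minimal S cover)

-- Numbers of k-supersets of a (t + 1)-set and of a (t + 2)-set.
C₁ C₂ : ℕ → ℕ → ℕ → ℕ
C₁ n k t = (n ∸ t ∸ 1) C (k ∸ t ∸ 1)
C₂ n k t = (n ∸ t ∸ 2) C (k ∸ t ∸ 2)

-- Part (i).  T₀ is the only t-cover of size t + 1.  A member A either contains T₀, or misses
-- some x ∈ T₀; then A ⊇ T₀ - x, and branching twice along deficient members of 𝓕 yields
-- y ∉ T₀ and z with A ⊇ (T₀ - x) ∪ {y, z}.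
module UniqueCover {n k t : ℕ} (t≤k : t ≤ k) (𝓕 : Family n)
  (uniform : IsKUniform k 𝓕) (intersecting : IsTIntersecting t 𝓕)
  (minimal : ∀ T → TCovers t 𝓕 T → suc t ≤ ∣ T ∣)
  (T₀ : Subset n) (T₀-cover : TCovers t 𝓕 T₀) (∣T₀∣≡1+t : ∣ T₀ ∣ ≡ suc t)
  (unique : ∀ T → 𝒯 t 𝓕 T → T ≡ T₀) where

  open Covers t 𝓕

  S : Fin n → Subset n
  S x = T₀ - x
  S⁺ : Fin n → Fin n → Subset n
  S⁺ x y = S x ∪ ⁅ y ⁆
  G₁ : Fin n → Subset n
  G₁ x = deficient (S x)
  G₂ : Fin n → Fin n → Subset n
  G₂ x y = deficient (S⁺ x y)

  Level₂ : Fin n → Fin n → Family n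
  Level₂ x y = Union (G₂ x y ─ S⁺ x y) (λ z → Star k (S⁺ x y ∪ ⁅ z ⁆))

  Level₁ : Fin n → Family n
  Level₁ x = Union (G₁ x ─ T₀) (Level₂ x)

  Cover : Family n
  Cover A = Star k T₀ A ∨ Union T₀ Level₁ A

  ∣S∣≡t : ∀ {x} → x ∈ₛ T₀ → ∣ S x ∣ ≡ t
  ∣S∣≡t x∈T₀ = suc-injective (trans (sym (x∈p⇒∣p∣≡1+∣p-x∣ x∈T₀)) ∣T₀∣≡1+t)

  ∣S⁺∣≡1+t : ∀ {x y} → x ∈ₛ T₀ → y ∉ₛ T₀ → ∣ S⁺ x y ∣ ≡ suc t
  ∣S⁺∣≡1+t {x} x∈T₀ y∉T₀ =
    trans (x∉p⇒∣p∪⁅x⁆∣≡1+∣p∣ (λ y∈S → y∉T₀ (p─q⊆p T₀ ⁅ x ⁆ y∈S))) (cong suc (∣S∣≡t x∈T₀))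

  -- S x is a t-set, hence not a t-cover.
  G₁-deficient : ∀ {x} → x ∈ₛ T₀ → Deficient (S x) (G₁ x)
  G₁-deficient {x} x∈T₀ = deficient-spec (S x) (small-not-cover minimal {S x} (∣S∣≡t x∈T₀))

  -- By uniqueness of T₀, the (t + 1)-set S⁺ x y ≠ T₀ is no t-cover.
  G₂-deficient : ∀ {x y} → x ∈ₛ T₀ → y ∉ₛ T₀ → Deficient (S⁺ x y) (G₂ x y)
  G₂-deficient {x} {y} x∈T₀ y∉T₀ = deficient-spec (S⁺ x y) λ cover →
    y∉T₀ (subst (y ∈ₛ_) (unique (S⁺ x y) (∣S⁺∣≡1+t x∈T₀ y∉T₀ , cover)) (x∈p∪q⁺ (inj₂ (x∈⁅x⁆ y))))

  T₀⊆S⁺∪⁅x⁆ : ∀ x y → T₀ ⊆ S⁺ x y ∪ ⁅ x ⁆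
  T₀⊆S⁺∪⁅x⁆ x y {u} u∈T₀ with u Fin.≟ x
  ... | yes refl = x∈p∪q⁺ (inj₂ (x∈⁅x⁆ x))
  ... | no  u≢x  = x∈p∪q⁺ (inj₁ (x∈p∪q⁺ (inj₁ (x∈p∧x≢y⇒x∈p-y u∈T₀ u≢x))))

  -- G₂ x y meets T₀ ⊆ S⁺ x y ∪ {x} in t points, so it has at most k - t + 1 points outside.
  count-Level₂ : ∀ {x y} → x ∈ₛ T₀ → y ∉ₛ T₀ → count n (Level₂ x y) ≤ (k ∸ t + 1) * C₂ n k t
  count-Level₂ {x} {y} x∈T₀ y∉T₀ = count-Union n (G₂ x y ─ S⁺ x y) _
    (subst (∣ G₂ x y ─ S⁺ x y ∣ ≤_) (+-∸-comm 1 t≤k)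
      (∣G─R∣≤ (G₂ x y) (S⁺ x y) (uniform _ 𝓕G₂) (cover-minus-one T₀-cover (T₀⊆S⁺∪⁅x⁆ x y) 𝓕G₂)))
    λ z z∈ → count-Star-size n k t 2 (S⁺ x y ∪ ⁅ z ⁆)
      (trans (x∉p⇒∣p∪⁅x⁆∣≡1+∣p∣ (x∈p─q⇒x∉q (G₂ x y) (S⁺ x y) z∈))
             (trans (cong suc (∣S⁺∣≡1+t x∈T₀ y∉T₀)) (+-comm 2 t)))
    where
    𝓕G₂ : 𝓕 (G₂ x y) ≡ true
    𝓕G₂ = proj₁ (G₂-deficient x∈T₀ y∉T₀)

  -- G₁ x meets the t-cover T₀ in t points, so it has at most k - t points outside T₀.
  count-Level₁ : ∀ {x} → x ∈ₛ T₀ → count n (Level₁ x) ≤ (k ∸ t) * ((k ∸ t + 1) * C₂ n k t)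
  count-Level₁ {x} x∈T₀ = count-Union n (G₁ x ─ T₀) _
    (subst (λ m → ∣ G₁ x ─ T₀ ∣ ≤ m ∸ t) (+-identityʳ k)
      (∣G─R∣≤ (G₁ x) T₀ (uniform _ 𝓕G₁) (≤-trans (T₀-cover _ 𝓕G₁) (m≤m+n _ 0))))
    λ y y∈ → count-Level₂ x∈T₀ (x∈p─q⇒x∉q (G₁ x) T₀ y∈)
    where
    𝓕G₁ : 𝓕 (G₁ x) ≡ true
    𝓕G₁ = proj₁ (G₁-deficient x∈T₀)

  count-Cover : count n Cover ≤ C₁ n k t + (t + 1) * ((k ∸ t) * ((k ∸ t + 1) * C₂ n k t))
  count-Cover = ≤-trans (count-∨ n (Star k T₀) (Union T₀ Level₁))
    (+-mono-≤ (count-Star-size n k t 1 T₀ ∣T₀∣≡t+1)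
              (count-Union n T₀ Level₁ (≤-reflexive ∣T₀∣≡t+1) (λ x → count-Level₁)))
    where
    ∣T₀∣≡t+1 : ∣ T₀ ∣ ≡ t + 1
    ∣T₀∣≡t+1 = trans ∣T₀∣≡1+t (+-comm 1 t)

  -- A member missing x ∈ T₀ still meets T₀ in t points, so it contains the t-set S x.
  S⊆member : ∀ {x A} → x ∈ₛ T₀ → x ∉ₛ A → 𝓕 A ≡ true → S x ⊆ A
  S⊆member {x} {A} x∈T₀ x∉A 𝓕A = ∣p∣≤∣p∩q∣⇒p⊆q (begin
    ∣ S x ∣         ≡⟨ ∣S∣≡t x∈T₀ ⟩
    t               ≤⟨ T₀-cover A 𝓕A ⟩
    ∣ T₀ ∩ A ∣      ≤⟨ p⊆q⇒∣p∣≤∣q∣ (p∩A⊆[p-x]∩A T₀ x∉A) ⟩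
    ∣ S x ∩ A ∣     ∎)
    where open ≤-Reasoning

  -- Such a member escapes G₁ x at some y ∉ T₀, and then G₂ x y at some z.
  missing-covered : ∀ {x A} → x ∈ₛ T₀ → x ∉ₛ A → 𝓕 A ≡ true → Level₁ x A ≡ true
  missing-covered {x} {A} x∈T₀ x∉A 𝓕A
    with y , y∈A , y∈G₁─T₀ ← escape intersecting {S x} {T₀} (G₁-deficient x∈T₀) 𝓕A
                               (λ u∈A u∈T₀ → x∈p∧x≢y⇒x∈p-y u∈T₀ (λ { refl → x∉A u∈A }))
    with z , z∈A , z∈G₂─S⁺ ← escape intersecting {S⁺ x y} {S⁺ x y} (G₂-deficient x∈T₀ (x∈p─q⇒x∉q (G₁ x) T₀ y∈G₁─T₀))
                               𝓕A (λ _ u∈S⁺ → u∈S⁺)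
    = Union-intro y∈G₁─T₀ (Union-intro z∈G₂─S⁺
        (Star-intro (∪⁅⁆-⊆ (∪⁅⁆-⊆ (S⊆member x∈T₀ x∉A 𝓕A) y∈A) z∈A) (uniform A 𝓕A)))

  covered : ∀ A → 𝓕 A ≡ true → Cover A ≡ true
  covered A 𝓕A with ⊆-or-Nonempty─ T₀ A
  ... | inj₁ T₀⊆A = ∨-introˡ _ (Star-intro T₀⊆A (uniform A 𝓕A))
  ... | inj₂ (x , x∈T₀─A) = ∨-introʳ (Star k T₀ A) (Union-intro (p─q⊆p T₀ A x∈T₀─A)
          (missing-covered (p─q⊆p T₀ A x∈T₀─A) (x∈p─q⇒x∉q T₀ A x∈T₀─A) 𝓕A))

  bound : card 𝓕 ≤ C₁ n k t + (t + 1) * (k ∸ t) * (k ∸ t + 1) * C₂ n k t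
  bound = begin
    card 𝓕          ≡⟨ card≡count 𝓕 ⟩
    count n 𝓕       ≤⟨ count-mono n covered ⟩
    count n Cover   ≤⟨ count-Cover ⟩
    C₁ n k t + (t + 1) * ((k ∸ t) * ((k ∸ t + 1) * C₂ n k t))
      ≡⟨ cong (C₁ n k t +_) (trans (*-assoc ((t + 1) * (k ∸ t)) _ _) (*-assoc (t + 1) (k ∸ t) _)) ⟨
    C₁ n k t + (t + 1) * (k ∸ t) * (k ∸ t + 1) * C₂ n k t ∎
    where open ≤-Reasoning

-- Part (ii).  𝒯 consists of the sets X ∪ {m} with m ∈ D = M ─ X.  A member A containing X
-- either meets D, or branches twice outside M; a member missing some x ∈ X contains M - x.
module PencilCovers {n k t l : ℕ} (t≤k : t ≤ k) (𝓕 : Family n)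
  (uniform : IsKUniform k 𝓕) (intersecting : IsTIntersecting t 𝓕)
  (minimal : ∀ T → TCovers t 𝓕 T → suc t ≤ ∣ T ∣)
  (X M : Subset n) (∣X∣≡t : ∣ X ∣ ≡ t) (∣M∣≡l : ∣ M ∣ ≡ l) (X⊆M : X ⊆ M)
  (char : ∀ T → 𝒯 t 𝓕 T ⇔ (∣ T ∣ ≡ t + 1 × T ⊆ M × X ⊆ T))
  (m₀ : Fin n) (m₀∈D : m₀ ∈ₛ M ─ X) where

  open Covers t 𝓕

  -- D is the set of points m with X ∪ {m} ∈ 𝒯; U x = M - x.
  D : Subset n
  D = M ─ X
  X⁺ : Fin n → Subset n
  X⁺ m = X ∪ ⁅ m ⁆
  U : Fin n → Subset n
  U x = M - x

  ∣X⁺∣≡1+t : ∀ {m} → m ∉ₛ X → ∣ X⁺ m ∣ ≡ suc t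
  ∣X⁺∣≡1+t m∉X = trans (x∉p⇒∣p∪⁅x⁆∣≡1+∣p∣ m∉X) (cong suc ∣X∣≡t)

  X⁺-cover : ∀ {m} → m ∈ₛ D → TCovers t 𝓕 (X⁺ m)
  X⁺-cover {m} m∈D = proj₂ (from (char (X⁺ m))
    (trans (∣X⁺∣≡1+t (x∈p─q⇒x∉q M X m∈D)) (+-comm 1 t) , ∪⁅⁆-⊆ X⊆M (p─q⊆p M X m∈D) , p⊆p∪q ⁅ m ⁆))

  X⁺-not-cover : ∀ {m} → m ∉ₛ M → ¬ TCovers t 𝓕 (X⁺ m)
  X⁺-not-cover {m} m∉M cover =
    m∉M (proj₁ (proj₂ (to (char (X⁺ m)) (∣X⁺∣≡1+t (m∉M ∘ X⊆M) , cover))) (x∈p∪q⁺ (inj₂ (x∈⁅x⁆ m))))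

  X-minus-one : ∀ {B} → 𝓕 B ≡ true → t ≤ ∣ X ∩ B ∣ + 1
  X-minus-one = cover-minus-one {R = X} {m₀} (X⁺-cover m₀∈D) ⊆-refl

  D⊆ : ∀ {B} → 𝓕 B ≡ true → ∣ X ∩ B ∣ < t → D ⊆ B
  D⊆ 𝓕B ∣X∩B∣<t {m} m∈D = cover-forces {R = X} {m} (X⁺-cover m∈D) ⊆-refl 𝓕B ∣X∩B∣<t

  outside-size : ∀ {G} R m → X⁺ m₀ ⊆ R ∪ ⁅ m ⁆ → 𝓕 G ≡ true → ∣ G ─ R ∣ ≤ k ∸ t + 1
  outside-size {G} R m X⁺m₀⊆ 𝓕G = subst (∣ G ─ R ∣ ≤_) (+-∸-comm 1 t≤k)
    (∣G─R∣≤ G R (uniform G 𝓕G) (cover-minus-one (X⁺-cover m₀∈D) X⁺m₀⊆ 𝓕G))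

  -- A member missing x ∈ X contains M - x: it contains X - x, as it still meets X in t - 1
  -- points, and it contains D, as it meets X in fewer than t points.
  U⊆ : ∀ {x A} → x ∈ₛ X → x ∉ₛ A → 𝓕 A ≡ true → U x ⊆ A
  U⊆ {x} {A} x∈X x∉A 𝓕A {u} u∈U with u ∈? X
  ... | yes u∈X = ∣p∣≤∣p∩q∣⇒p⊆q ∣X-x∣≤ (x∈p∧x≢y⇒x∈p-y u∈X (x∉⁅y⁆⇒x≢y (x∈p─q⇒x∉q M ⁅ x ⁆ u∈U)))
    where
    ∣X-x∣≤ : ∣ X - x ∣ ≤ ∣ (X - x) ∩ A ∣
    ∣X-x∣≤ = ≤-pred (begin
      suc ∣ X - x ∣             ≡⟨ trans (sym (x∈p⇒∣p∣≡1+∣p-x∣ x∈X)) ∣X∣≡t ⟩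
      t                         ≤⟨ X-minus-one 𝓕A ⟩
      ∣ X ∩ A ∣ + 1             ≤⟨ +-monoˡ-≤ 1 (p⊆q⇒∣p∣≤∣q∣ (p∩A⊆[p-x]∩A X x∉A)) ⟩
      ∣ (X - x) ∩ A ∣ + 1       ≡⟨ +-comm _ 1 ⟩
      suc ∣ (X - x) ∩ A ∣       ∎)
      where open ≤-Reasoning
  ... | no  u∉X = D⊆ 𝓕A ∣X∩A∣<t (x∈p∧x∉q⇒x∈p─q (p─q⊆p M ⁅ x ⁆ u∈U) u∉X)
    where
    ∣X∩A∣<t : ∣ X ∩ A ∣ < t
    ∣X∩A∣<t = begin-strict
      ∣ X ∩ A ∣            ≤⟨ p⊆q⇒∣p∣≤∣q∣ (p∩A⊆[p-x]∩A X x∉A) ⟩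
      ∣ (X - x) ∩ A ∣      ≤⟨ ∣p∩q∣≤∣p∣ (X - x) A ⟩
      ∣ X - x ∣            <⟨ n<1+n _ ⟩
      suc ∣ X - x ∣        ≡⟨ trans (sym (x∈p⇒∣p∣≡1+∣p-x∣ x∈X)) ∣X∣≡t ⟩
      t                    ∎
      where open ≤-Reasoning

  -- The deficient members of X (a t-set) and of X ∪ {y} for y ∉ M (a (t + 1)-set not in 𝒯).
  G₀ : Subset n
  G₀ = deficient X
  G⁺ : Fin n → Subset n
  G⁺ y = deficient (X⁺ y)

  G₀-deficient : Deficient X G₀
  G₀-deficient = deficient-spec X (small-not-cover minimal {X} ∣X∣≡t)

  G⁺-deficient : ∀ {y} → y ∉ₛ M → Deficient (X⁺ y) (G⁺ y)
  G⁺-deficient y∉M = deficient-spec _ (X⁺-not-cover y∉M)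

  ThroughD : Family n
  ThroughD = Union D (λ m → Star k (X⁺ m))

  Beyond : Fin n → Family n
  Beyond y = Union (G⁺ y ─ X⁺ y) (λ z → Star k (X⁺ y ∪ ⁅ z ⁆))

  OutsideM : Family n
  OutsideM = Union (G₀ ─ M) Beyond

  -- A member containing X but avoiding D meets M only in X; it escapes G₀ at some y ∉ M
  -- and then G⁺ y at some z.
  avoiding-D-covered : ∀ {A} → 𝓕 A ≡ true → X ⊆ A → D ⊆ ∁ A → OutsideM A ≡ true
  avoiding-D-covered {A} 𝓕A X⊆A D⊆∁A
    with y , y∈A , y∈G₀─M ← escape intersecting {X} {M} G₀-deficient 𝓕A (λ {u} u∈A u∈M →
                              decidable-stable (u ∈? X) λ u∉X →
                                x∈∁p⇒x∉p (D⊆∁A (x∈p∧x∉q⇒x∈p─q u∈M u∉X)) u∈A)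
    with z , z∈A , z∈G⁺─X⁺ ← escape intersecting {X⁺ y} {X⁺ y} (G⁺-deficient (x∈p─q⇒x∉q G₀ M y∈G₀─M))
                               𝓕A (λ _ u∈X⁺ → u∈X⁺)
    = Union-intro y∈G₀─M (Union-intro z∈G⁺─X⁺ (Star-intro (∪⁅⁆-⊆ (∪⁅⁆-⊆ X⊆A y∈A) z∈A) (uniform A 𝓕A)))

  -- Every member lies in ThroughD or OutsideM, or misses some x ∈ X; in the last case it
  -- lies in any family Q x that contains the members missing x.
  covered-by : (Q : Fin n → Family n) →
    (∀ {x A} → x ∈ₛ X → x ∉ₛ A → 𝓕 A ≡ true → Q x A ≡ true) →
    ∀ A → 𝓕 A ≡ true → (ThroughD A ∨ (OutsideM A ∨ Union X Q A)) ≡ true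
  covered-by Q missing A 𝓕A with ⊆-or-Nonempty─ X A
  ... | inj₂ (x , x∈X─A) = ∨-introʳ (ThroughD A) (∨-introʳ (OutsideM A)
        (Union-intro (p─q⊆p X A x∈X─A) (missing (p─q⊆p X A x∈X─A) (x∈p─q⇒x∉q X A x∈X─A) 𝓕A)))
  ... | inj₁ X⊆A with ⊆-or-Nonempty─ D (∁ A)
  ...   | inj₂ (m , m∈D─∁A) = ∨-introˡ _ (Union-intro (p─q⊆p D (∁ A) m∈D─∁A)
            (Star-intro (∪⁅⁆-⊆ X⊆A (x∉∁p⇒x∈p (x∈p─q⇒x∉q D (∁ A) m∈D─∁A))) (uniform A 𝓕A)))
  ...   | inj₁ D⊆∁A = ∨-introʳ (ThroughD A) (∨-introˡ _ (avoiding-D-covered 𝓕A X⊆A D⊆∁A))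

  ∣D∣≡l∸t : ∣ D ∣ ≡ l ∸ t
  ∣D∣≡l∸t = begin
    ∣ D ∣                      ≡⟨ m+n∸m≡n t ∣ D ∣ ⟨
    t + ∣ D ∣ ∸ t              ≡⟨ cong (λ s → s + ∣ D ∣ ∸ t) (trans (cong ∣_∣ M∩X≡X) ∣X∣≡t) ⟨
    ∣ M ∩ X ∣ + ∣ D ∣ ∸ t      ≡⟨ cong (_∸ t) (trans (sym (∣p∣≡∣p∩q∣+∣p─q∣ M X)) ∣M∣≡l) ⟩
    l ∸ t                      ∎
    where
    open ≡-Reasoning
    M∩X≡X : M ∩ X ≡ X
    M∩X≡X = ⊆-antisym (p∩q⊆q M X) (λ x∈X → x∈p∩q⁺ (X⊆M x∈X , x∈X))

  -- G₀ misses at most one point of X (X-minus-one) and contains D (D⊆), so it contains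
  -- all but at most one point of M.
  l≤∣M∩G₀∣+1 : l ≤ ∣ M ∩ G₀ ∣ + 1
  l≤∣M∩G₀∣+1 = begin
    l                          ≡⟨ trans (sym ∣M∣≡l) (∣p∣≡∣p∩q∣+∣p─q∣ M G₀) ⟩
    ∣ M ∩ G₀ ∣ + ∣ M ─ G₀ ∣    ≤⟨ +-monoʳ-≤ ∣ M ∩ G₀ ∣ (≤-trans (p⊆q⇒∣p∣≤∣q∣ M─G₀⊆X─G₀) ∣X─G₀∣≤1) ⟩
    ∣ M ∩ G₀ ∣ + 1             ∎
    where
    open ≤-Reasoning
    ∣X─G₀∣≤1 : ∣ X ─ G₀ ∣ ≤ 1
    ∣X─G₀∣≤1 = +-cancelˡ-≤ ∣ X ∩ G₀ ∣ _ _ (begin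
      ∣ X ∩ G₀ ∣ + ∣ X ─ G₀ ∣  ≡⟨ trans (sym (∣p∣≡∣p∩q∣+∣p─q∣ X G₀)) ∣X∣≡t ⟩
      t                        ≤⟨ X-minus-one (proj₁ G₀-deficient) ⟩
      ∣ X ∩ G₀ ∣ + 1           ∎)
    M─G₀⊆X─G₀ : M ─ G₀ ⊆ X ─ G₀
    M─G₀⊆X─G₀ {u} u∈M─G₀ with u ∈? X
    ... | yes u∈X = x∈p∧x∉q⇒x∈p─q u∈X (x∈p─q⇒x∉q M G₀ u∈M─G₀)
    ... | no  u∉X = contradiction
          (D⊆ (proj₁ G₀-deficient) (proj₂ G₀-deficient) (x∈p∧x∉q⇒x∈p─q (p─q⊆p M G₀ u∈M─G₀) u∉X))
          (x∈p─q⇒x∉q M G₀ u∈M─G₀)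

  count-ThroughD : count n ThroughD ≤ (l ∸ t) * C₁ n k t
  count-ThroughD = count-Union n D _ (≤-reflexive ∣D∣≡l∸t) λ m m∈D →
    count-Star-size n k t 1 (X⁺ m) (trans (∣X⁺∣≡1+t (x∈p─q⇒x∉q M X m∈D)) (+-comm 1 t))

  -- G⁺ y has at most k - t + 1 points outside X ∪ {y}, since X ∪ {m₀} ⊆ (X ∪ {y}) ∪ {m₀}.
  count-Beyond : ∀ {y} → y ∉ₛ M → count n (Beyond y) ≤ (k ∸ t + 1) * C₂ n k t
  count-Beyond {y} y∉M = count-Union n (G⁺ y ─ X⁺ y) _
    (outside-size (X⁺ y) m₀ (∪⁅⁆-⊆ (λ u∈X → x∈p∪q⁺ (inj₁ (x∈p∪q⁺ (inj₁ u∈X)))) (x∈p∪q⁺ (inj₂ (x∈⁅x⁆ m₀))))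
      (proj₁ (G⁺-deficient y∉M)))
    λ z z∈ → count-Star-size n k t 2 (X⁺ y ∪ ⁅ z ⁆)
      (trans (x∉p⇒∣p∪⁅x⁆∣≡1+∣p∣ (x∈p─q⇒x∉q (G⁺ y) (X⁺ y) z∈))
             (trans (cong suc (∣X⁺∣≡1+t (y∉M ∘ X⊆M))) (+-comm 2 t)))

  -- G₀ has at most k + 1 - l points outside M.
  count-OutsideM : count n OutsideM ≤ (k + 1 ∸ l) * ((k ∸ t + 1) * C₂ n k t)
  count-OutsideM = count-Union n (G₀ ─ M) _ (∣G─R∣≤ G₀ M (uniform G₀ (proj₁ G₀-deficient)) l≤∣M∩G₀∣+1)
    (λ y y∈ → count-Beyond (x∈p─q⇒x∉q G₀ M y∈))

  count-covering : (Q : Fin n → Family n) → ∀ {b} → (∀ x → x ∈ₛ X → count n (Q x) ≤ b) →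
    count n (λ A → ThroughD A ∨ (OutsideM A ∨ Union X Q A))
      ≤ (l ∸ t) * C₁ n k t + ((k + 1 ∸ l) * ((k ∸ t + 1) * C₂ n k t) + t * b)
  count-covering Q bound =
    ≤-trans (count-∨ n ThroughD _)
      (+-mono-≤ count-ThroughD
        (≤-trans (count-∨ n OutsideM _)
          (+-mono-≤ count-OutsideM (count-Union n X Q (≤-reflexive ∣X∣≡t) bound))))

  MissesAt : Fin n → Family n
  MissesAt x = Layer k (U x) (∁ ⁅ x ⁆)

  MissesAt-member : ∀ {x A} → x ∈ₛ X → x ∉ₛ A → 𝓕 A ≡ true → MissesAt x A ≡ true
  MissesAt-member {x} x∈X x∉A 𝓕A = Layer-intro (U⊆ x∈X x∉A 𝓕A)
    (λ {u} u∈A → x∉p⇒x∈∁p (x≢y⇒x∉⁅y⁆ λ { refl → x∉A u∈A })) (uniform _ 𝓕A)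

  -- |M - x| = l - 1 and |∁ {x}| = n - 1, so the layer has at most C(n - l, k + 1 - l) sets.
  count-MissesAt : ∀ x → x ∈ₛ X → count n (MissesAt x) ≤ (n ∸ l) C (k + 1 ∸ l)
  count-MissesAt x x∈X =
    subst (λ m → count n (MissesAt x) ≤ (n ∸ m) C (k + 1 ∸ m)) (sym l≡1+∣U∣)
      (≤-trans (count-Layer n k (U x) (∁ ⁅ x ⁆) (λ u∈U → x∉p⇒x∈∁p (x∈p─q⇒x∉q M ⁅ x ⁆ u∈U)))
               (≤-reflexive (cong₂ _C_ (trans (cong (_∸ ∣ U x ∣) ∣∁⁅x⁆∣≡n∸1) (∸-+-assoc n 1 ∣ U x ∣))
                                       (cong (_∸ suc ∣ U x ∣) (+-comm 1 k)))))
    where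
    l≡1+∣U∣ : l ≡ suc ∣ U x ∣
    l≡1+∣U∣ = trans (sym ∣M∣≡l) (x∈p⇒∣p∣≡1+∣p-x∣ (X⊆M x∈X))
    ∣∁⁅x⁆∣≡n∸1 : ∣ ∁ ⁅ x ⁆ ∣ ≡ n ∸ 1
    ∣∁⁅x⁆∣≡n∸1 = trans (∣∁p∣≡n∸∣p∣ ⁅ x ⁆) (cong (n ∸_) (∣⁅x⁆∣≡1 x))

  bound : card 𝓕 ≤ (l ∸ t) * C₁ n k t + (k + 1 ∸ l) * (k ∸ t + 1) * C₂ n k t
                  + t * ((n ∸ l) C (k + 1 ∸ l))
  bound = begin
    card 𝓕                     ≡⟨ card≡count 𝓕 ⟩
    count n 𝓕                  ≤⟨ count-mono n (covered-by MissesAt MissesAt-member) ⟩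
    count n (λ A → ThroughD A ∨ (OutsideM A ∨ Union X MissesAt A))
                               ≤⟨ count-covering MissesAt count-MissesAt ⟩
    (l ∸ t) * C₁ n k t + ((k + 1 ∸ l) * ((k ∸ t + 1) * C₂ n k t) + C₃)
      ≡⟨ trans (+-assoc ((l ∸ t) * C₁ n k t) _ _)
               (cong (λ s → (l ∸ t) * C₁ n k t + (s + C₃)) (*-assoc (k + 1 ∸ l) (k ∸ t + 1) _)) ⟨
    (l ∸ t) * C₁ n k t + (k + 1 ∸ l) * (k ∸ t + 1) * C₂ n k t + C₃ ∎
    where
    open ≤-Reasoning
    C₃ : ℕ
    C₃ = t * ((n ∸ l) C (k + 1 ∸ l))

  M⊆U∪⁅x⁆ : ∀ x → M ⊆ U x ∪ ⁅ x ⁆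
  M⊆U∪⁅x⁆ x {u} u∈M with u Fin.≟ x
  ... | yes refl = x∈p∪q⁺ (inj₂ (x∈⁅x⁆ x))
  ... | no  u≢x  = x∈p∪q⁺ (inj₁ (x∈p∧x≢y⇒x∈p-y u∈M u≢x))

  -- When l = t + 2, each M - x (x ∈ X) is a (t + 1)-set outside 𝒯 (it misses x ∈ X), so the
  -- members missing x can be branched once more along a deficient member of M - x.
  module Refined (1+t≤k : suc t ≤ k) (l≡t+2 : l ≡ t + 2) where

    ∣U∣≡1+t : ∀ {x} → x ∈ₛ X → ∣ U x ∣ ≡ suc t
    ∣U∣≡1+t x∈X = suc-injective
      (trans (sym (x∈p⇒∣p∣≡1+∣p-x∣ (X⊆M x∈X))) (trans ∣M∣≡l (trans l≡t+2 (+-comm t 2))))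

    H : Fin n → Subset n
    H x = deficient (U x)

    H-deficient : ∀ {x} → x ∈ₛ X → Deficient (U x) (H x)
    H-deficient {x} x∈X = deficient-spec (U x) λ cover → x∈p─q⇒x∉q M ⁅ x ⁆
      (proj₂ (proj₂ (to (char (U x)) (∣U∣≡1+t x∈X , cover))) x∈X) (x∈⁅x⁆ x)

    BeyondU : Fin n → Family n
    BeyondU x = Union (H x ─ U x) (λ z → Star k (U x ∪ ⁅ z ⁆))

    BeyondU-member : ∀ {x A} → x ∈ₛ X → x ∉ₛ A → 𝓕 A ≡ true → BeyondU x A ≡ true
    BeyondU-member {x} {A} x∈X x∉A 𝓕A
      with z , z∈A , z∈H─U ← escape intersecting {U x} {U x} (H-deficient x∈X) 𝓕A (λ _ u∈U → u∈U)
      = Union-intro z∈H─U (Star-intro (∪⁅⁆-⊆ (U⊆ x∈X x∉A 𝓕A) z∈A) (uniform A 𝓕A))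

    count-BeyondU : ∀ x → x ∈ₛ X → count n (BeyondU x) ≤ (k ∸ t + 1) * C₂ n k t
    count-BeyondU x x∈X = count-Union n (H x ─ U x) _
      (outside-size (U x) x (⊆-trans (∪⁅⁆-⊆ X⊆M (p─q⊆p M X m₀∈D)) (M⊆U∪⁅x⁆ x))
        (proj₁ (H-deficient x∈X)))
      λ z z∈ → count-Star-size n k t 2 (U x ∪ ⁅ z ⁆)
        (trans (x∉p⇒∣p∪⁅x⁆∣≡1+∣p∣ (x∈p─q⇒x∉q (H x) (U x) z∈))
               (trans (cong suc (∣U∣≡1+t x∈X)) (+-comm 2 t)))

    k+1∸l+t≡k∸1 : k + 1 ∸ l + t ≡ k ∸ 1
    k+1∸l+t≡k∸1 with r , refl ← m≤n⇒∃[o]m+o≡n 1+t≤k rewrite l≡t+2 = begin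
      suc t + r + 1 ∸ (t + 2) + t   ≡⟨ cong (λ s → s ∸ (t + 2) + t) (shuffle t r) ⟩
      t + 2 + r ∸ (t + 2) + t       ≡⟨ cong (_+ t) (m+n∸m≡n (t + 2) r) ⟩
      r + t                         ≡⟨ +-comm r t ⟩
      t + r                         ∎
      where
      open ≡-Reasoning
      shuffle : ∀ t r → suc t + r + 1 ≡ t + 2 + r
      shuffle = solve-∀

    refined-bound : card 𝓕 ≤ 2 * C₁ n k t + (k ∸ 1) * (k ∸ t + 1) * C₂ n k t
    refined-bound = begin
      card 𝓕                   ≡⟨ card≡count 𝓕 ⟩
      count n 𝓕                ≤⟨ count-mono n (covered-by BeyondU BeyondU-member) ⟩
      count n (λ A → ThroughD A ∨ (OutsideM A ∨ Union X BeyondU A))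
                               ≤⟨ count-covering BeyondU count-BeyondU ⟩
      (l ∸ t) * C₁ n k t + ((k + 1 ∸ l) * B + t * B)
                               ≡⟨ cong₂ _+_ (cong (λ m → (m ∸ t) * C₁ n k t) (sym l≡t+2))
                                            (*-distribʳ-+ B (k + 1 ∸ l) t) ⟨
      (t + 2 ∸ t) * C₁ n k t + (k + 1 ∸ l + t) * B
                               ≡⟨ cong₂ _+_ (cong (_* C₁ n k t) (m+n∸m≡n t 2))
                                            (trans (cong (_* B) k+1∸l+t≡k∸1) (sym (*-assoc (k ∸ 1) _ _))) ⟩
      2 * C₁ n k t + (k ∸ 1) * (k ∸ t + 1) * C₂ n k t ∎
      where
      open ≤-Reasoning
      B : ℕ
      B = (k ∸ t + 1) * C₂ n k t

insertFam-cases : ∀ {n} (𝓕 : Family n) {G B} → insertFam 𝓕 G B ≡ true → 𝓕 B ≡ true ⊎ B ≡ G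
insertFam-cases 𝓕 {G} {B} ins with 𝓕 B | ≡-dec Bool._≟_ B G
... | true  | _         = inj₁ refl
... | false | yes B≡G   = inj₂ B≡G
... | false | no  _     = contradiction ins λ ()

maximal-closed : ∀ {n k t} {𝓕 : Family n} → IsMaximalTIntersecting k t 𝓕 → t ≤ k →
  ∀ {G} → ∣ G ∣ ≡ k → (∀ B → 𝓕 B ≡ true → t ≤ ∣ G ∩ B ∣) → 𝓕 G ≡ true
maximal-closed {t = t} {𝓕} (_ , intersecting , maximal) t≤k {G} ∣G∣≡k meets with 𝓕 G in 𝓕G
... | true  = refl
... | false = contradiction extended (maximal G ∣G∣≡k 𝓕G)
  where
  extended : IsTIntersecting t (insertFam 𝓕 G)
  extended A B insA insB with insertFam-cases 𝓕 insA | insertFam-cases 𝓕 insB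
  ... | inj₁ 𝓕A   | inj₁ 𝓕B   = intersecting A B 𝓕A 𝓕B
  ... | inj₂ refl | inj₁ 𝓕B   = meets B 𝓕B
  ... | inj₁ 𝓕A   | inj₂ refl = subst (λ q → t ≤ ∣ q ∣) (∩-comm G A) (meets A 𝓕A)
  ... | inj₂ refl | inj₂ refl = subst (λ q → t ≤ ∣ q ∣) (sym (∩-idem G)) (subst (t ≤_) (sym ∣G∣≡k) t≤k)

-- Part (iii).  Every (t + 1)-subset Z - x of Z is a t-cover, so every member meets Z in at
-- least t + 1 points; conversely such k-sets are t-intersecting with all members (as
-- |Z| = t + 2), hence members by maximality.
module FullCovers {n k t : ℕ} (1≤t : 1 ≤ t) (t≤k : t ≤ k) (𝓕 : Family n)
  (maximal : IsMaximalTIntersecting k t 𝓕) (Z : Subset n) (∣Z∣≡t+2 : ∣ Z ∣ ≡ t + 2)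
  (char : ∀ T → 𝒯 t 𝓕 T ⇔ (∣ T ∣ ≡ t + 1 × T ⊆ Z)) where

  Z-x-cover : ∀ {x} → x ∈ₛ Z → TCovers t 𝓕 (Z - x)
  Z-x-cover {x} x∈Z = proj₂ (from (char (Z - x))
    (suc-injective (trans (sym (x∈p⇒∣p∣≡1+∣p-x∣ x∈Z)) (trans ∣Z∣≡t+2 (+-suc t 1))) , p─q⊆p Z ⁅ x ⁆))

  [Z-x]∩A⊆[A∩Z]-x : ∀ x A → (Z - x) ∩ A ⊆ (A ∩ Z) - x
  [Z-x]∩A⊆[A∩Z]-x x A u∈ =
    let (u∈Z-x , u∈A) = x∈p∩q⁻ (Z - x) A u∈
    in x∈p∧x∉q⇒x∈p─q (x∈p∩q⁺ (u∈A , p─q⊆p Z ⁅ x ⁆ u∈Z-x)) (x∈p─q⇒x∉q Z ⁅ x ⁆ u∈Z-x)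

  Z-nonempty : Nonempty Z
  Z-nonempty = 1≤∣p∣⇒Nonempty (subst (1 ≤_) (trans (+-comm 2 t) (sym ∣Z∣≡t+2)) (s≤s z≤n))

  -- Through any Z - z a member meets Z in t ≥ 1 points; then through Z - a, for a point a
  -- of A ∩ Z, it meets Z in t points besides a.
  member-meets-Z : ∀ {A} → 𝓕 A ≡ true → suc t ≤ ∣ A ∩ Z ∣
  member-meets-Z {A} 𝓕A
    with z , z∈Z ← Z-nonempty
    with a , a∈A∩Z ← 1≤∣p∣⇒Nonempty {p = A ∩ Z} (≤-trans 1≤t (≤-trans (Z-x-cover z∈Z A 𝓕A)
                       (p⊆q⇒∣p∣≤∣q∣ (p─q⊆p (A ∩ Z) ⁅ z ⁆ ∘ [Z-x]∩A⊆[A∩Z]-x z A))))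
    = begin
    suc t                      ≤⟨ s≤s (Z-x-cover (p∩q⊆q A Z a∈A∩Z) A 𝓕A) ⟩
    suc ∣ (Z - a) ∩ A ∣        ≤⟨ s≤s (p⊆q⇒∣p∣≤∣q∣ ([Z-x]∩A⊆[A∩Z]-x a A)) ⟩
    suc ∣ (A ∩ Z) - a ∣        ≡⟨ x∈p⇒∣p∣≡1+∣p-x∣ a∈A∩Z ⟨
    ∣ A ∩ Z ∣                  ∎
    where open ≤-Reasoning

  meet-via-Z : ∀ {A B} → suc t ≤ ∣ A ∩ Z ∣ → suc t ≤ ∣ B ∩ Z ∣ → t ≤ ∣ A ∩ B ∣
  meet-via-Z {A} {B} A-meets B-meets = +-cancelʳ-≤ (t + 2) t ∣ A ∩ B ∣ (begin
    t + (t + 2)                ≡⟨ trans (cong (t +_) (+-comm t 2)) (+-suc t (suc t)) ⟩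
    suc t + suc t              ≤⟨ +-mono-≤ A-meets B-meets ⟩
    ∣ A ∩ Z ∣ + ∣ B ∩ Z ∣      ≤⟨ ∣p∩r∣+∣q∩r∣≤∣p∩q∣+∣r∣ A B Z ⟩
    ∣ A ∩ B ∣ + ∣ Z ∣          ≡⟨ cong (∣ A ∩ B ∣ +_) ∣Z∣≡t+2 ⟩
    ∣ A ∩ B ∣ + (t + 2)        ∎)
    where open ≤-Reasoning

  card≡h₂ : card 𝓕 ≡ h₂ k t Z
  card≡h₂ = trans (card≡count 𝓕) (trans (count-cong n meets-Z meets-Z⇒member) (sym (card≡count {n} _)))
    where
    uniform : IsKUniform k 𝓕
    uniform = proj₁ maximal
    meets-Z : ∀ A → 𝓕 A ≡ true → ((∣ A ∣ ≡ᵇ k) ∧ (suc t ≤ᵇ ∣ A ∩ Z ∣)) ≡ true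
    meets-Z A 𝓕A = to T-≡ (from T-∧ (≡⇒≡ᵇ ∣ A ∣ k (uniform A 𝓕A) , ≤⇒≤ᵇ (member-meets-Z 𝓕A)))
    meets-Z⇒member : ∀ A → ((∣ A ∣ ≡ᵇ k) ∧ (suc t ≤ᵇ ∣ A ∩ Z ∣)) ≡ true → 𝓕 A ≡ true
    meets-Z⇒member A h =
      let (∣A∣≡k , A-meets) = to T-∧ (from T-≡ h)
      in maximal-closed maximal t≤k (≡ᵇ⇒≡ ∣ A ∣ k ∣A∣≡k)
           (λ B 𝓕B → meet-via-Z {A} {B} (≤ᵇ⇒≤ (suc t) ∣ A ∩ Z ∣ A-meets) (member-meets-Z 𝓕B))

HasCard-1-unique : ∀ {n} {P : Subset n → Set} → HasCard P 1 → ∀ {T T′} → P T → P T′ → T ≡ T′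
HasCard-1-unique (_ ∷ [] , _ , iff , _) {T} {T′} PT PT′ with from (iff T) PT | from (iff T′) PT′
... | Any.here T≡ | Any.here T′≡ = trans T≡ (sym T′≡)

HasCard-witness : ∀ {n} {P : Subset n → Set} {m} → 1 ≤ m → HasCard P m → ∃ P
HasCard-witness 1≤m ([]    , _ , iff , refl) = contradiction 1≤m λ ()
HasCard-witness 1≤m (T ∷ _ , _ , iff , _)    = T , to (iff T) (Any.here refl)

t≤k∸2⇒t<k : ∀ {t} k → 1 ≤ t → t ≤ k ∸ 2 → t < k
t≤k∸2⇒t<k zero          1≤t t≤0 = contradiction (≤-trans 1≤t t≤0) λ ()
t≤k∸2⇒t<k (suc zero)    1≤t t≤0 = contradiction (≤-trans 1≤t t≤0) λ ()
t≤k∸2⇒t<k (suc (suc k)) _   t≤k = s≤s (m≤n⇒m≤1+n t≤k)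

pencil-point : ∀ {n t c} {𝓕 : Family n} {X M : Subset n} → 1 ≤ c → HasCard (𝒯 t 𝓕) c →
  ∣ X ∣ ≡ t → (∀ T → 𝒯 t 𝓕 T ⇔ (∣ T ∣ ≡ t + 1 × T ⊆ M × X ⊆ T)) → Nonempty (M ─ X)
pencil-point {t = t} {X = X} {M} 1≤c many ∣X∣≡t char
  with (T₁ , T₁∈𝒯) ← HasCard-witness 1≤c many
  with (∣T₁∣≡t+1 , T₁⊆M , _) ← to (char T₁) T₁∈𝒯
  with (m , m∈T₁─X) ← larger⇒Nonempty─ {T = T₁} {X}
                        (subst₂ _<_ (sym ∣X∣≡t) (sym ∣T₁∣≡t+1) (m<m+n t (s≤s z≤n)))
  = m , x∈p∧x∉q⇒x∈p─q (T₁⊆M (p─q⊆p T₁ X m∈T₁─X)) (x∈p─q⇒x∉q T₁ X m∈T₁─X)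

lemma3p3 : (n k t : ℕ) → 1 ≤ t → t ≤ k ∸ 2 → 2 * k ≤ n →
    (𝓕 : Family n) → IsMaximalTIntersecting k t 𝓕 → TCoveringNumberIs t 𝓕 (suc t) →
    (HasCard (𝒯 t 𝓕) 1 →
      card 𝓕 ≤ ((n ∸ t ∸ 1) C (k ∸ t ∸ 1))
               + (t + 1) * (k ∸ t) * (k ∸ t + 1) * ((n ∸ t ∸ 2) C (k ∸ t ∸ 2)))
    × (∀ (c l : ℕ) (X M : Subset n) → 2 ≤ c → HasCard (𝒯 t 𝓕) c →
        ∣ X ∣ ≡ t → ∣ M ∣ ≡ l → X ⊆ M →
        (∀ T → 𝒯 t 𝓕 T ⇔ (∣ T ∣ ≡ t + 1 × T ⊆ M × X ⊆ T)) →
        (card 𝓕 ≤ (l ∸ t) * ((n ∸ t ∸ 1) C (k ∸ t ∸ 1))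
                   + (k + 1 ∸ l) * (k ∸ t + 1) * ((n ∸ t ∸ 2) C (k ∸ t ∸ 2))
                   + t * ((n ∸ l) C (k + 1 ∸ l)))
        × (l ≡ t + 2 →
            card 𝓕 ≤ 2 * ((n ∸ t ∸ 1) C (k ∸ t ∸ 1))
                     + (k ∸ 1) * (k ∸ t + 1) * ((n ∸ t ∸ 2) C (k ∸ t ∸ 2))))
    × (∀ (c : ℕ) (Z : Subset n) → 2 ≤ c → HasCard (𝒯 t 𝓕) c → ∣ Z ∣ ≡ t + 2 →
        (∀ T → 𝒯 t 𝓕 T ⇔ (∣ T ∣ ≡ t + 1 × T ⊆ Z)) →
        card 𝓕 ≡ h₂ k t Z)
lemma3p3 n k t 1≤t t≤k∸2 _ 𝓕 maximal@(uniform , intersecting , _) ((T₀ , T₀-cover , ∣T₀∣≡1+t) , minimal) =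
  (λ one → UniqueCover.bound t≤k 𝓕 uniform intersecting minimal T₀ T₀-cover ∣T₀∣≡1+t
             (λ T T∈𝒯 → HasCard-1-unique one T∈𝒯 (∣T₀∣≡1+t , T₀-cover))) ,
  (λ c l X M 2≤c many ∣X∣≡t ∣M∣≡l X⊆M char →
    let (m₀ , m₀∈M─X) = pencil-point (≤-trans (s≤s z≤n) 2≤c) many ∣X∣≡t char
        open PencilCovers t≤k 𝓕 uniform intersecting minimal X M ∣X∣≡t ∣M∣≡l X⊆M char m₀ m₀∈M─X
    in bound , Refined.refined-bound t<k) ,
  (λ c Z _ _ ∣Z∣≡t+2 char → FullCovers.card≡h₂ 1≤t t≤k 𝓕 maximal Z ∣Z∣≡t+2 char)
  where
  t<k : t < k
  t<k = t≤k∸2⇒t<k k 1≤t t≤k∸2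
  t≤k : t ≤ k
  t≤k = <⇒≤ t<k
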